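{- Let $H$ be any outcome of the spanner construction below, and fix $\Delta>5$. Let $0\le i<k$ and let $x,y\in V$ satisfy $d_G(x,y)\ge (3\Delta)^iW(x,y)$. Then at least one of the following holds: (1) $d_H(x,y)\le \left(1+\frac{8i}{\Delta-5}\right)d_G(x,y)$; (2) $d_H(x,p_{i+1}(x))\le \frac{2\Delta}{\Delta-5}\,d_G(x,y)$.
   Context: Let $G=(V,E,w)$ be an undirected graph on $n$ vertices with non-negative edge weights, $d_G$ its shortest-path distance, and $k\ge1$ an integer; $\nu=1/((4/3)^k-1)$. For $x,y\in V$, $W(x,y)=\max\{w(e):e\in P_{xy}\}$ where $P_{xy}$ is a shortest $x$–$y$ path in $G$ (ties between shortest paths broken consistently). Let $A_0=V$, $A_k=\emptyset$, and for $0\le i\le k-2$ let $A_{i+1}$ be obtained by including each element of $A_i$ independently with probability $q_i=n^{ -4^i\nu/3^{i+1}}$. For $0\le i\le k-1$ and $v\in V$, the pivot $p_i(v)$ is the vertex of $A_i$ closest to $v$ in $d_G$ (ties broken lexicographically); $p_k(v)$ does not exist, and a condition bounding the distance from $x$ to $p_k(x)$ is regarded as false. Let $d_G(u,A_{i+1})=\min_{a\in A_{i+1}}d_G(u,a)$ ($=\infty$ if $A_{i+1}=\emptyset$). For $u\in A_i\setminus A_{i+1}$ the half bunch is $B_{1/2}(u)=\{v\in A_i: d_G(u,v)<d_G(u,A_{i+1})/2\}\cup\{p_j(u):i<j<k\}$. $H$ is the subgraph of $G$ formed by the union of the shortest paths $P_{uv}$ over all $u\in V$, $v\in B_{1/2}(u)$;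 $d_H$ is its shortest-path distance.
   Formalization: The edge weights and the parameter Δ are rational. -}

module Defs where

open import Data.Nat as ℕ using (ℕ; zero; suc)
open import Data.Integer using (+_)
open import Data.Rational as ℚ using (ℚ; 0ℚ; 1ℚ; ½; _+_; _*_; _-_; _÷_; _⊔_; _⊓_; _/_; Positive; NonZero)
open import Data.Rational.Properties using (+-monoˡ-<; +-inverseʳ; pos⇒nonZero)
open import Data.Fin using (Fin; toℕ)
open import Data.Fin.Subset using (Subset; _∈_; _∉_; _⊆_) renaming (⊤ to Full; ⊥ to Empty)
open import Data.Fin.Subset.Properties using (_∈?_)
open import Data.List using (List; []; _∷_; _++_; reverse; foldr; map; filter; head; last; allFin)
open import Data.List.Relation.Unary.All using (All)
open import Data.List.Relation.Unary.Unique.Propositional using (Unique)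
open import Data.Maybe using (Maybe; just; nothing; fromMaybe)
open import Data.Product using (Σ; _×_; _,_; ∃)
open import Data.Sum using (_⊎_)
open import Data.Unit using (⊤)
open import Relation.Nullary using (¬_)
open import Relation.Binary.PropositionalEquality using (_≡_; subst)
open import Data.List.Membership.Propositional using () renaming (_∈_ to _∈ₗ_)

ℕ→ℚ : ℕ → ℚ
ℕ→ℚ m = + m / 1

_^ℚ_ : ℚ → ℕ → ℚ
q ^ℚ zero = 1ℚ
q ^ℚ suc m = q * (q ^ℚ m)

private
  pos-sub5 : (Δ : ℚ) → ℕ→ℚ 5 ℚ.< Δ → Positive (Δ - ℕ→ℚ 5)
  pos-sub5 Δ h = ℚ.positive {Δ - ℕ→ℚ 5} (subst (ℚ._< Δ - ℕ→ℚ 5) (+-inverseʳ (ℕ→ℚ 5))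
                                   (+-monoˡ-< (ℚ.- ℕ→ℚ 5) {ℕ→ℚ 5} {Δ} h))

inv-sub5 : (Δ : ℚ) → ℕ→ℚ 5 ℚ.< Δ → ℚ
inv-sub5 Δ h = _÷_ 1ℚ (Δ - ℕ→ℚ 5) {{pos⇒nonZero (Δ - ℕ→ℚ 5) {{pos-sub5 Δ h}}}}

data ℚ∞ : Set where
  fin : ℚ → ℚ∞
  ∞   : ℚ∞

data _≤∞_ : ℚ∞ → ℚ∞ → Set where
  fin≤fin : ∀ {p q} → p ℚ.≤ q → fin p ≤∞ fin q
  _≤∞∞    : ∀ a → a ≤∞ ∞

data _<∞_ : ℚ∞ → ℚ∞ → Set where
  fin<fin : ∀ {p q} → p ℚ.< q → fin p <∞ fin q
  fin<∞   : ∀ {p} → fin p <∞ ∞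

half∞ : ℚ∞ → ℚ∞
half∞ (fin q) = fin (q * ½)
half∞ ∞       = ∞

_⊓∞_ : ℚ∞ → ℚ∞ → ℚ∞
fin p ⊓∞ fin q = fin (p ⊓ q)
fin p ⊓∞ ∞     = fin p
∞     ⊓∞ b     = b

record Graph (n : ℕ) : Set where
  field
    w       : Fin n → Fin n → Maybe ℚ
    w-sym   : ∀ u v → w u v ≡ w v u
    w-nonneg : ∀ u v q → w u v ≡ just q → 0ℚ ℚ.≤ q
open Graph public

module _ {n : ℕ} (G : Graph n) where

  pairs : List (Fin n) → List (Fin n × Fin n)
  pairs []            = []
  pairs (u ∷ [])      = []
  pairs (u ∷ v ∷ vs)  = (u , v) ∷ pairs (v ∷ vs)

  Adj : Fin n × Fin n → Set
  Adj (u , v) = ∃ λ q → w G u v ≡ just q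

  wt : Fin n × Fin n → ℚ
  wt (u , v) = fromMaybe 0ℚ (w G u v)

  len : List (Fin n) → ℚ
  len vs = foldr _+_ 0ℚ (map wt (pairs vs))

  -- maximum edge weight on a walk (0 for a walk without edges)
  maxW : List (Fin n) → ℚ
  maxW vs = foldr _⊔_ 0ℚ (map wt (pairs vs))

  Walk : (Fin n → Fin n → Set) → Fin n → Fin n → List (Fin n) → Set
  Walk E x y vs = (head vs ≡ just x) × (last vs ≡ just y)
                × All Adj (pairs vs) × All (λ { (u , v) → E u v }) (pairs vs)

  AllEdges : Fin n → Fin n → Set
  AllEdges _ _ = ⊤

  IsDist : (Fin n → Fin n → Set) → Fin n → Fin n → ℚ∞ → Set
  IsDist E x y ∞       = ¬ (∃ λ vs → Walk E x y vs)
  IsDist E x y (fin d) = (∃ λ vs → Walk E x y vs × len vs ≡ d)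
                       × (∀ vs → Walk E x y vs → d ℚ.≤ len vs)

  -- P is a choice of shortest paths P_xy in G (w.r.t. distance dG),
  -- with ties broken consistently (symmetric and closed under subpaths)
  record ShortestPathChoice (dG : Fin n → Fin n → ℚ∞)
                            (P : Fin n → Fin n → Maybe (List (Fin n))) : Set where
    field
      spec : ∀ x y → (P x y ≡ nothing × dG x y ≡ ∞)
                   ⊎ (∃ λ vs → P x y ≡ just vs × Walk AllEdges x y vs × Unique vs
                                × dG x y ≡ fin (len vs))
      symm : ∀ x y vs → P x y ≡ just vs → P y x ≡ just (reverse vs)
      subpath : ∀ x y as bs cs u v → P x y ≡ just (as ++ bs ++ cs)
              → head bs ≡ just u → last bs ≡ just v → P u v ≡ just bs

  -- the sets A_0 ⊇ A_1 ⊇ ... ⊇ A_k form a possible outcome of the sampling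
  record Outcome (k : ℕ) (A : ℕ → Subset n) : Set where
    field
      A0 : A 0 ≡ Full
      Ak : A k ≡ Empty
      nested : ∀ j → suc j ℕ.< k → A (suc j) ⊆ A j
      -- if n = 1 every sampling probability q_j equals 1
      trivial : 1 ≡ n → ∀ j → suc j ℕ.< k → A (suc j) ≡ A j

  distSet : (Fin n → Fin n → ℚ∞) → Fin n → Subset n → ℚ∞
  distSet dG u S = foldr _⊓∞_ ∞ (map (dG u) (filter (_∈? S) (allFin n)))

  IsPivot : ℕ → (ℕ → Subset n) → (Fin n → Fin n → ℚ∞) → ℕ → Fin n → Fin n → Set
  IsPivot k A dG j u p = j ℕ.< k × p ∈ A j
                       × (∀ a → a ∈ A j → dG u p ≤∞ dG u a)
                       × (∀ a → a ∈ A j → dG u a ≡ dG u p → toℕ p ℕ.≤ toℕ a)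

  InHalfBunch : ℕ → (ℕ → Subset n) → (Fin n → Fin n → ℚ∞) → Fin n → Fin n → Set
  InHalfBunch k A dG u v =
    ∃ λ i → i ℕ.< k × u ∈ A i × u ∉ A (suc i)
          × ((v ∈ A i × dG u v <∞ half∞ (distSet dG u (A (suc i))))
             ⊎ (∃ λ j → i ℕ.< j × IsPivot k A dG j u v))

  InH : ℕ → (ℕ → Subset n) → (Fin n → Fin n → ℚ∞)
      → (Fin n → Fin n → Maybe (List (Fin n))) → Fin n → Fin n → Set
  InH k A dG P a b = ∃ λ u → ∃ λ v → ∃ λ vs → InHalfBunch k A dG u v × P u v ≡ just vs
                   × (((a , b) ∈ₗ pairs vs) ⊎ ((b , a) ∈ₗ pairs vs))

module Submission where

-- For i = 0, either y lies in the half bunch of x, so that P_xy ⊆ H, or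
-- d(x, A₁) ≤ 2 d(x,y) and the pivot p₁(x), which H reaches at its G-distance, is close.
-- For the step put T = (3Δ)^i W(x,y).  Since no edge of P_xy is longer than W, the path
-- can be cut into consecutive pieces of length in [T, T + W], to which the induction
-- hypothesis applies.  If it gives the first alternative on every piece, H stretches P_xy
-- by at most 1 + 8i/(Δ-5).  Otherwise it fails at some m when marching from x, and at some
-- m′ when marching back from y; the pivots z₁ of m and z₂ of m′ have level i + 1 and lie
-- within 3T · 2Δ/(Δ-5) of them in H.  Either A_{i+2} meets the ball of radius 2 d(z₁,z₂)
-- around z₁, which gives x a close pivot of level i + 2, or z₂ is in the half bunch of z₁
-- and the detour x → m → z₁ → z₂ → m′ → y lies in H.  Both bounds use 3ΔT ≤ d(x,y).

open import Defs
open import Data.Nat using (ℕ; suc; _≤_; _<_) renaming (_*_ to _*ℕ_)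
open import Data.Rational using (ℚ; 1ℚ; _+_; _*_) renaming (_≤_ to _≤ℚ_; _<_ to _<ℚ_)
open import Data.Fin using (Fin)
open import Data.Fin.Subset using (Subset)
open import Data.List using (List)
open import Data.Maybe using (Maybe; just)
open import Data.Product using (∃; _×_)
open import Data.Sum using (_⊎_)
open import Relation.Binary.PropositionalEquality using (_≡_)

open import Data.Nat using (zero)
import Data.Nat as ℕ
import Data.Nat.Properties as ℕ
open import Data.Nat.Coprimality using (1-coprimeTo)
import Data.Nat.Coprimality as Coprime
import Data.Integer as ℤ
import Data.Integer.Properties as ℤ
open import Data.Rational using (0ℚ; ½; _-_; _⊔_)
import Data.Rational as ℚ
import Data.Rational.Properties as ℚ
open import Data.Rational.Solver using (module +-*-Solver)
import Data.Rational.Unnormalised as ℚᵘ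
import Data.Rational.Unnormalised.Properties as ℚᵘ
open import Data.Fin using (toℕ)
import Data.Fin.Properties as Fin
open import Data.Fin.Subset using (_∈_; _∉_)
open import Data.Fin.Subset.Properties using (_∈?_; ∉⊥; ∈⊤)
open import Data.List using ([]; _∷_; _++_; _∷ʳ_; reverse; foldr; map; head; last; length; allFin)
import Data.List.Properties as List
open import Data.List.Relation.Unary.All as All using (All; []; _∷_)
import Data.List.Relation.Unary.All.Properties as All
open import Data.List.Relation.Unary.Any using (here; there)
open import Data.List.Membership.Propositional using () renaming (_∈_ to _∈ₗ_)
open import Data.List.Membership.Propositional.Properties using (∈-allFin)
open import Data.Maybe using (nothing; fromMaybe)
open import Data.Product using (_,_; proj₁; proj₂)
open import Data.Sum using (inj₁; inj₂; [_,_]′)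
open import Data.Empty using (⊥-elim)
open import Function using (_∘_)
open import Relation.Nullary using (¬_; Dec; yes; no)
open import Relation.Nullary.Decidable using (_×-dec_; toWitness)
open import Relation.Binary using (Symmetric; tri<; tri≈; tri>)
open import Relation.Binary.PropositionalEquality using (refl; sym; trans; cong; cong₂; subst; module ≡-Reasoning)

sumℚ : List ℚ → ℚ
sumℚ = foldr _+_ 0ℚ

sumℚ-++ : ∀ xs ys → sumℚ (xs ++ ys) ≡ sumℚ xs + sumℚ ys
sumℚ-++ []       ys = sym (ℚ.+-identityˡ _)
sumℚ-++ (x ∷ xs) ys = trans (cong (x +_) (sumℚ-++ xs ys)) (sym (ℚ.+-assoc x _ _))

sumℚ-reverse : ∀ xs → sumℚ (reverse xs) ≡ sumℚ xs
sumℚ-reverse []       = refl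
sumℚ-reverse (x ∷ xs) = begin
  sumℚ (reverse (x ∷ xs))      ≡⟨ cong sumℚ (List.unfold-reverse x xs) ⟩
  sumℚ (reverse xs ++ x ∷ [])  ≡⟨ sumℚ-++ (reverse xs) _ ⟩
  sumℚ (reverse xs) + (x + 0ℚ) ≡⟨ cong₂ _+_ (sumℚ-reverse xs) (ℚ.+-identityʳ x) ⟩
  sumℚ xs + x                  ≡⟨ ℚ.+-comm _ x ⟩
  x + sumℚ xs                  ∎
  where open ≡-Reasoning

module _ {A : Set} where

  All-reverse⁺ : ∀ {P : A → Set} xs → All P xs → All P (reverse xs)
  All-reverse⁺ []       []       = []
  All-reverse⁺ (x ∷ xs) (p ∷ ps) =
    subst (All _) (sym (List.unfold-reverse x xs)) (All.++⁺ (All-reverse⁺ xs ps) (p ∷ []))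

  last⇒∷ʳ : ∀ (vs : List A) y → last vs ≡ just y → ∃ λ as → vs ≡ as ∷ʳ y
  last⇒∷ʳ (x ∷ [])     y refl = [] , refl
  last⇒∷ʳ (x ∷ z ∷ vs) y eq   with last⇒∷ʳ (z ∷ vs) y eq
  ... | as , e = x ∷ as , cong (x ∷_) e

  last-∷ʳ : ∀ (as : List A) y → last (as ∷ʳ y) ≡ just y
  last-∷ʳ []           y = refl
  last-∷ʳ (a ∷ [])     y = refl
  last-∷ʳ (a ∷ b ∷ as) y = last-∷ʳ (b ∷ as) y

  last-++-∷ : ∀ (as : List A) m bs → last (as ++ m ∷ bs) ≡ last (m ∷ bs)
  last-++-∷ []           m bs = refl
  last-++-∷ (a ∷ [])     m bs = refl
  last-++-∷ (a ∷ b ∷ as) m bs = last-++-∷ (b ∷ as) m bs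

  head-++-∷ : ∀ (as : List A) m bs → head (as ++ m ∷ bs) ≡ head (as ∷ʳ m)
  head-++-∷ []       m bs = refl
  head-++-∷ (a ∷ as) m bs = refl

swap : ∀ {A : Set} → A × A → A × A
swap (a , b) = b , a

module _ {n : ℕ} (G : Graph n) where

  pairs-++-∷ : ∀ as (m : Fin n) bs → pairs G (as ++ m ∷ bs) ≡ pairs G (as ∷ʳ m) ++ pairs G (m ∷ bs)
  pairs-++-∷ []           m bs = refl
  pairs-++-∷ (a ∷ [])     m bs = refl
  pairs-++-∷ (a ∷ b ∷ as) m bs = cong ((a , b) ∷_) (pairs-++-∷ (b ∷ as) m bs)

  pairs-reverse : ∀ (ws : List (Fin n)) → pairs G (reverse ws) ≡ reverse (map swap (pairs G ws))
  pairs-reverse []             = refl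
  pairs-reverse (u ∷ [])       = refl
  pairs-reverse (u ∷ v ∷ rest) = begin
    pairs G (reverse (u ∷ v ∷ rest))
      ≡⟨ cong (pairs G) reverse-uv ⟩
    pairs G (reverse rest ++ v ∷ u ∷ [])
      ≡⟨ pairs-++-∷ (reverse rest) v (u ∷ []) ⟩
    pairs G (reverse rest ∷ʳ v) ++ (v , u) ∷ []
      ≡⟨ cong (λ z → pairs G z ++ (v , u) ∷ []) (sym (List.unfold-reverse v rest)) ⟩
    pairs G (reverse (v ∷ rest)) ++ (v , u) ∷ []
      ≡⟨ cong (_++ (v , u) ∷ []) (pairs-reverse (v ∷ rest)) ⟩
    reverse (map swap (pairs G (v ∷ rest))) ++ (v , u) ∷ []
      ≡⟨ sym (List.unfold-reverse (v , u) (map swap (pairs G (v ∷ rest)))) ⟩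
    reverse (map swap (pairs G (u ∷ v ∷ rest))) ∎
    where
    open ≡-Reasoning
    reverse-uv : reverse (u ∷ v ∷ rest) ≡ reverse rest ++ v ∷ u ∷ []
    reverse-uv = trans (List.unfold-reverse u (v ∷ rest))
      (trans (cong (_∷ʳ u) (List.unfold-reverse v rest)) (List.++-assoc (reverse rest) (v ∷ []) (u ∷ [])))

  wt-swap : ∀ p → wt G (swap p) ≡ wt G p
  wt-swap (a , b) = cong (fromMaybe 0ℚ) (w-sym G b a)

  wt-nonneg : ∀ p → 0ℚ ≤ℚ wt G p
  wt-nonneg (a , b) with w G a b in eq
  ... | just q  = w-nonneg G a b q eq
  ... | nothing = ℚ.≤-refl

  len-++-∷ : ∀ as (m : Fin n) bs → len G (as ++ m ∷ bs) ≡ len G (as ∷ʳ m) + len G (m ∷ bs)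
  len-++-∷ as m bs = begin
    sumℚ (map (wt G) (pairs G (as ++ m ∷ bs)))
      ≡⟨ cong (sumℚ ∘ map (wt G)) (pairs-++-∷ as m bs) ⟩
    sumℚ (map (wt G) (pairs G (as ∷ʳ m) ++ pairs G (m ∷ bs)))
      ≡⟨ cong sumℚ (List.map-++ (wt G) (pairs G (as ∷ʳ m)) _) ⟩
    sumℚ (map (wt G) (pairs G (as ∷ʳ m)) ++ map (wt G) (pairs G (m ∷ bs)))
      ≡⟨ sumℚ-++ (map (wt G) (pairs G (as ∷ʳ m))) _ ⟩
    len G (as ∷ʳ m) + len G (m ∷ bs) ∎
    where open ≡-Reasoning

  len-reverse : ∀ ws → len G (reverse ws) ≡ len G ws
  len-reverse ws = begin
    sumℚ (map (wt G) (pairs G (reverse ws)))          ≡⟨ cong (sumℚ ∘ map (wt G)) (pairs-reverse ws) ⟩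
    sumℚ (map (wt G) (reverse (map swap (pairs G ws)))) ≡⟨ cong sumℚ (List.reverse-map (wt G) (map swap (pairs G ws))) ⟩
    sumℚ (reverse (map (wt G) (map swap (pairs G ws)))) ≡⟨ sumℚ-reverse (map (wt G) (map swap (pairs G ws))) ⟩
    sumℚ (map (wt G) (map swap (pairs G ws)))          ≡⟨ cong sumℚ (sym (List.map-∘ (pairs G ws))) ⟩
    sumℚ (map (wt G ∘ swap) (pairs G ws))              ≡⟨ cong sumℚ (List.map-cong wt-swap (pairs G ws)) ⟩
    len G ws                                           ∎
    where open ≡-Reasoning

  len-nonneg : ∀ ws → 0ℚ ≤ℚ len G ws
  len-nonneg ws = go (pairs G ws)
    where
    go : ∀ ps → 0ℚ ≤ℚ sumℚ (map (wt G) ps)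
    go []       = ℚ.≤-refl
    go (p ∷ ps) = ℚ.+-mono-≤ (wt-nonneg p) (go ps)

  maxW-nonneg : ∀ ws → 0ℚ ≤ℚ maxW G ws
  maxW-nonneg ws = go (pairs G ws)
    where
    go : ∀ ps → 0ℚ ≤ℚ foldr _⊔_ 0ℚ (map (wt G) ps)
    go []       = ℚ.≤-refl
    go (p ∷ ps) = ℚ.≤-trans (go ps) (ℚ.p≤q⊔p (wt G p) _)

  Light : ℚ → List (Fin n) → Set
  Light W ws = All (λ p → wt G p ≤ℚ W) (pairs G ws)

  light-maxW : ∀ ws → Light (maxW G ws) ws
  light-maxW ws = go (pairs G ws)
    where
    go : ∀ ps → All (λ p → wt G p ≤ℚ foldr _⊔_ 0ℚ (map (wt G) ps)) ps
    go []       = []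
    go (p ∷ ps) = ℚ.p≤p⊔q (wt G p) _ ∷ All.map (λ h → ℚ.≤-trans h (ℚ.p≤q⊔p (wt G p) _)) (go ps)

  maxW-least : ∀ {W} ws → 0ℚ ≤ℚ W → Light W ws → maxW G ws ≤ℚ W
  maxW-least {W} ws W≥0 = go (pairs G ws)
    where
    go : ∀ ps → All (λ p → wt G p ≤ℚ W) ps → foldr _⊔_ 0ℚ (map (wt G) ps) ≤ℚ W
    go []       []       = W≥0
    go (p ∷ ps) (h ∷ hs) = ℚ.⊔-lub h (go ps hs)

  light-reverse : ∀ {W} ws → Light W ws → Light W (reverse ws)
  light-reverse ws h = subst (All _) (sym (pairs-reverse ws))
    (All-reverse⁺ _ (All.map⁺ (All.map (λ {p} → subst (_≤ℚ _) (sym (wt-swap p))) h)))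

  adj-swap : ∀ p → Adj G p → Adj G (swap p)
  adj-swap (a , b) (q , e) = q , trans (w-sym G b a) e

  walk-++ : ∀ {E x m y ws₁ ws₂} → Walk G E x m ws₁ → Walk G E m y ws₂
          → ∃ λ ws → Walk G E x y ws × len G ws ≡ len G ws₁ + len G ws₂
  walk-++ {ws₁ = ws₁} {m ∷ bs} (h₁ , l₁ , a₁ , e₁) (refl , l₂ , a₂ , e₂) with last⇒∷ʳ ws₁ m l₁
  ... | as , refl =
    as ++ m ∷ bs ,
    (trans (head-++-∷ as m bs) h₁ , trans (last-++-∷ as m bs) l₂ ,
     subst (All _) (sym (pairs-++-∷ as m bs)) (All.++⁺ a₁ a₂) ,
     subst (All _) (sym (pairs-++-∷ as m bs)) (All.++⁺ e₁ e₂)) ,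
    len-++-∷ as m bs

  walk-reverse : ∀ {E x y ws} → Symmetric E → Walk G E x y ws → Walk G E y x (reverse ws)
  walk-reverse {ws = x ∷ bs} E-sym (refl , l , a , e) with last⇒∷ʳ (x ∷ bs) _ l
  ... | as , eq =
    (cong head (trans (cong reverse eq) (List.reverse-++ as (_ ∷ []))) ,
     trans (cong last (List.unfold-reverse x bs)) (last-∷ʳ (reverse bs) x) ,
     reverse-pairs (All.map (λ {p} → adj-swap p) a) ,
     reverse-pairs (All.map (λ { {a , b} → E-sym }) e))
    where
    reverse-pairs : ∀ {Q : Fin n × Fin n → Set}
                  → All (Q ∘ swap) (pairs G (x ∷ bs)) → All Q (pairs G (reverse (x ∷ bs)))
    reverse-pairs h = subst (All _) (sym (pairs-reverse (x ∷ bs))) (All-reverse⁺ _ (All.map⁺ h))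

  walk-mono : ∀ {E E′ x y ws} → (∀ {a b} → E a b → E′ a b) → Walk G E x y ws → Walk G E′ x y ws
  walk-mono f (h , l , a , e) = h , l , a , All.map f e

  walk-trivial : ∀ {E} x → Walk G E x x (x ∷ [])
  walk-trivial x = refl , refl , [] , []

  light-++-∷ : ∀ {W} as (m : Fin n) bs → Light W (as ++ m ∷ bs) → Light W (as ∷ʳ m) × Light W (m ∷ bs)
  light-++-∷ as m bs h = All.++⁻ (pairs G (as ∷ʳ m)) (subst (All _) (pairs-++-∷ as m bs) h)

  light-prefix-from : ∀ {T W} s u v rest → s ≤ℚ T → Light W (u ∷ v ∷ rest) → T ≤ℚ s + len G (u ∷ v ∷ rest)
                    → ∃ λ as → ∃ λ m → ∃ λ bs → u ∷ v ∷ rest ≡ (u ∷ as) ++ m ∷ bs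
                        × T ≤ℚ s + len G ((u ∷ as) ∷ʳ m) × s + len G ((u ∷ as) ∷ʳ m) ≤ℚ T + W
  light-prefix-from s u v [] s≤T (w≤W ∷ []) T≤ =
    [] , v , [] , refl , T≤ , ℚ.+-mono-≤ s≤T (subst (_≤ℚ _) (sym (ℚ.+-identityʳ _)) w≤W)
  light-prefix-from {T} {W} s u v (r ∷ rest) s≤T (w≤W ∷ light) T≤ with T ℚ.≤? s + (wt G (u , v) + 0ℚ)
  ... | yes T≤′ = [] , v , r ∷ rest , refl , T≤′ , ℚ.+-mono-≤ s≤T (subst (_≤ℚ W) (sym (ℚ.+-identityʳ _)) w≤W)
  ... | no T≰ =
    let as , m , bs , eq , lo , hi = light-prefix-from (s + wt G (u , v)) v r rest s′≤T light
                                       (subst (T ≤ℚ_) (sym (ℚ.+-assoc s _ _)) T≤)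
    in v ∷ as , m , bs , cong (u ∷_) eq ,
       subst (T ≤ℚ_) (ℚ.+-assoc s _ _) lo , subst (_≤ℚ T + W) (ℚ.+-assoc s _ _) hi
    where
    s′≤T : s + wt G (u , v) ≤ℚ T
    s′≤T = ℚ.<⇒≤ (ℚ.≰⇒> (T≰ ∘ subst (T ≤ℚ_) (cong (s +_) (sym (ℚ.+-identityʳ _)))))

  light-prefix : ∀ {T W} u v rest → 0ℚ ≤ℚ T → Light W (u ∷ v ∷ rest) → T ≤ℚ len G (u ∷ v ∷ rest)
               → ∃ λ as → ∃ λ m → ∃ λ bs → u ∷ v ∷ rest ≡ (u ∷ as) ++ m ∷ bs
                   × T ≤ℚ len G ((u ∷ as) ∷ʳ m) × len G ((u ∷ as) ∷ʳ m) ≤ℚ T + W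
  light-prefix {T} {W} u v rest 0≤T light T≤ =
    let as , m , bs , eq , lo , hi =
          light-prefix-from 0ℚ u v rest 0≤T light (subst (T ≤ℚ_) (sym (ℚ.+-identityˡ _)) T≤)
    in as , m , bs , eq , subst (T ≤ℚ_) (ℚ.+-identityˡ _) lo , subst (_≤ℚ T + W) (ℚ.+-identityˡ _) hi

≤∞-refl : ∀ {a} → a ≤∞ a
≤∞-refl {fin x} = fin≤fin ℚ.≤-refl
≤∞-refl {∞}     = ∞ ≤∞∞

≤∞-reflexive : ∀ {a b} → a ≡ b → a ≤∞ b
≤∞-reflexive refl = ≤∞-refl

≤∞-antisym : ∀ {a b} → a ≤∞ b → b ≤∞ a → a ≡ b
≤∞-antisym (fin≤fin p) (fin≤fin q) = cong fin (ℚ.≤-antisym p q)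
≤∞-antisym (_ ≤∞∞)     (_ ≤∞∞)     = refl

≤∞-trans : ∀ {a b c} → a ≤∞ b → b ≤∞ c → a ≤∞ c
≤∞-trans (fin≤fin p) (fin≤fin q) = fin≤fin (ℚ.≤-trans p q)
≤∞-trans {a} _       (_ ≤∞∞)     = a ≤∞∞

≤∞-fin⇒fin : ∀ {a q} → a ≤∞ fin q → ∃ λ p → a ≡ fin p × p ≤ℚ q
≤∞-fin⇒fin (fin≤fin {p} x) = p , refl , x

fin-injective : ∀ {p q} → fin p ≡ fin q → p ≡ q
fin-injective refl = refl

<∞⇒≤∞ : ∀ {a b} → a <∞ b → a ≤∞ b
<∞⇒≤∞ (fin<fin p) = fin≤fin (ℚ.<⇒≤ p)
<∞⇒≤∞ {a} fin<∞   = a ≤∞∞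

<∞⇒≱∞ : ∀ {a b} → a <∞ b → ¬ b ≤∞ a
<∞⇒≱∞ (fin<fin p) (fin≤fin q) = ℚ.<-irrefl refl (ℚ.<-≤-trans p q)

_≤∞?_ : ∀ a b → Dec (a ≤∞ b)
fin p ≤∞? fin q with p ℚ.≤? q
... | yes h = yes (fin≤fin h)
... | no h  = no λ { (fin≤fin x) → h x }
a     ≤∞? ∞     = yes (a ≤∞∞)
∞     ≤∞? fin q = no λ ()

≰∞⇒>∞ : ∀ {a b} → ¬ a ≤∞ b → b <∞ a
≰∞⇒>∞ {fin p} {fin q} h = fin<fin (ℚ.≰⇒> (h ∘ fin≤fin))
≰∞⇒>∞ {∞}     {fin q} h = fin<∞
≰∞⇒>∞ {a}     {∞}     h = ⊥-elim (h (a ≤∞∞))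

data Ordering∞ (a b : ℚ∞) : Set where
  less    : a <∞ b → Ordering∞ a b
  equal   : a ≡ b → Ordering∞ a b
  greater : b <∞ a → Ordering∞ a b

compare∞ : ∀ a b → Ordering∞ a b
compare∞ (fin p) (fin q) with ℚ.<-cmp p q
... | tri< x _ _ = less (fin<fin x)
... | tri≈ _ e _ = equal (cong fin e)
... | tri> _ _ x = greater (fin<fin x)
compare∞ (fin p) ∞       = less fin<∞
compare∞ ∞       (fin q) = greater fin<∞
compare∞ ∞       ∞       = equal refl

⊓∞-glb-< : ∀ {c} a b → fin c <∞ a → fin c <∞ b → fin c <∞ (a ⊓∞ b)
⊓∞-glb-< {c} (fin p) (fin q) (fin<fin x) (fin<fin y) with ℚ.⊓-sel p q
... | inj₁ e = fin<fin (subst (c ℚ.<_) (sym e) x)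
... | inj₂ e = fin<fin (subst (c ℚ.<_) (sym e) y)
⊓∞-glb-< (fin p) ∞ x y = x
⊓∞-glb-< ∞       b x y = y

foldr-⊓∞-glb-< : ∀ {c} (as : List ℚ∞) → All (fin c <∞_) as → fin c <∞ foldr _⊓∞_ ∞ as
foldr-⊓∞-glb-< []       []       = fin<∞
foldr-⊓∞-glb-< (a ∷ as) (p ∷ ps) = ⊓∞-glb-< a _ p (foldr-⊓∞-glb-< as ps)

+≤⇒<half∞ : ∀ {g c} D → g + g ≤ℚ c → fin c <∞ D → fin g <∞ half∞ D
+≤⇒<half∞ {g} (fin q) g+g≤c (fin<fin c<q) =
  fin<fin (subst (ℚ._< q * ½) half-double (ℚ.*-monoˡ-<-pos ½ (ℚ.≤-<-trans g+g≤c c<q)))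
  where
  half-double : (g + g) * ½ ≡ g
  half-double = trans (ℚ.*-distribʳ-+ ½ g g) (trans (sym (ℚ.*-distribˡ-+ g ½ ½)) (ℚ.*-identityʳ g))
+≤⇒<half∞ ∞ _ fin<∞ = fin<∞

module Distance {n : ℕ} (G : Graph n) (E : Fin n → Fin n → Set) (D : Fin n → Fin n → ℚ∞)
                (D-spec : ∀ x y → IsDist G E x y (D x y)) where

  dist≤len : ∀ {x y ws} → Walk G E x y ws → D x y ≤∞ fin (len G ws)
  dist≤len {x} {y} {ws} w with D x y | D-spec x y
  ... | fin d | _ , minimal = fin≤fin (minimal ws w)
  ... | ∞     | no-walk     = ⊥-elim (no-walk (ws , w))

  dist-walk : ∀ {x y b} → D x y ≤∞ fin b → ∃ λ ws → Walk G E x y ws × len G ws ≤ℚ b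
  dist-walk {x} {y} {b} h with D x y | D-spec x y
  dist-walk {x} {y} {b} (fin≤fin h) | fin d | (ws , w , l) , _ = ws , w , subst (_≤ℚ b) (sym l) h

  dist-nonneg : ∀ {x y b} → D x y ≤∞ fin b → 0ℚ ≤ℚ b
  dist-nonneg h with dist-walk h
  ... | ws , _ , l = ℚ.≤-trans (len-nonneg G ws) l

  dist-refl : ∀ x → D x x ≤∞ fin 0ℚ
  dist-refl x = dist≤len {ws = x ∷ []} (walk-trivial G x)

  dist-triangle : ∀ {x y z a b} → D x y ≤∞ fin a → D y z ≤∞ fin b → D x z ≤∞ fin (a + b)
  dist-triangle h₁ h₂ with dist-walk h₁ | dist-walk h₂
  ... | ws₁ , w₁ , l₁ | ws₂ , w₂ , l₂ with walk-++ G w₁ w₂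
  ... | ws , w , l = ≤∞-trans (dist≤len w) (fin≤fin (subst (_≤ℚ _) (sym l) (ℚ.+-mono-≤ l₁ l₂)))

  dist-sym : Symmetric E → ∀ {x y a} → D x y ≤∞ fin a → D y x ≤∞ fin a
  dist-sym E-sym h with dist-walk h
  ... | ws , w , l =
    ≤∞-trans (dist≤len (walk-reverse G E-sym w)) (fin≤fin (subst (_≤ℚ _) (sym (len-reverse G ws)) l))

  dist-weaken : ∀ {x y a b} → D x y ≤∞ fin a → a ≤ℚ b → D x y ≤∞ fin b
  dist-weaken h l = ≤∞-trans h (fin≤fin l)

module _ {n : ℕ} (f : Fin n → ℚ∞) where

  _≼_ : Fin n → Fin n → Set
  p ≼ a = f p ≤∞ f a × (f a ≡ f p → toℕ p ℕ.≤ toℕ a)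

  ≼-refl : ∀ {p} → p ≼ p
  ≼-refl = ≤∞-refl , λ _ → ℕ.≤-refl

  ≼-trans : ∀ {p a b} → p ≼ a → a ≼ b → p ≼ b
  ≼-trans (pa , pa-tie) (ab , ab-tie) =
    ≤∞-trans pa ab , λ fb≡fp →
      let fa≡fp = ≤∞-antisym (≤∞-trans ab (≤∞-reflexive fb≡fp)) pa
      in ℕ.≤-trans (pa-tie fa≡fp) (ab-tie (trans fb≡fp (sym fa≡fp)))

  ≼-total : ∀ p a → p ≼ a ⊎ a ≼ p
  ≼-total p a with compare∞ (f p) (f a)
  ... | less fp<fa    = inj₁ (<∞⇒≤∞ fp<fa , λ fa≡fp → ⊥-elim (<∞⇒≱∞ fp<fa (≤∞-reflexive fa≡fp)))
  ... | greater fa<fp = inj₂ (<∞⇒≤∞ fa<fp , λ fp≡fa → ⊥-elim (<∞⇒≱∞ fa<fp (≤∞-reflexive fp≡fa)))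
  ... | equal fp≡fa with ℕ.≤-total (toℕ p) (toℕ a)
  ...   | inj₁ p≤a = inj₁ (≤∞-reflexive fp≡fa , λ _ → p≤a)
  ...   | inj₂ a≤p = inj₂ (≤∞-reflexive (sym fp≡fa) , λ _ → a≤p)

  argmin : (S : Subset n) (xs : List (Fin n))
         → (∀ a → a ∈ₗ xs → a ∉ S) ⊎ (∃ λ p → p ∈ S × ∀ a → a ∈ₗ xs → a ∈ S → p ≼ a)
  argmin S []       = inj₁ λ _ ()
  argmin S (y ∷ ys) with y ∈? S | argmin S ys
  ... | no y∉S | inj₁ none = inj₁ λ { a (here refl) → y∉S ; a (there a∈) → none a a∈ }
  ... | no y∉S | inj₂ (p , p∈S , min) =
    inj₂ (p , p∈S , λ { a (here refl) a∈S → ⊥-elim (y∉S a∈S) ; a (there a∈) → min a a∈ })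
  ... | yes y∈S | inj₁ none =
    inj₂ (y , y∈S , λ { a (here refl) _ → ≼-refl ; a (there a∈) a∈S → ⊥-elim (none a a∈ a∈S) })
  ... | yes y∈S | inj₂ (p , p∈S , min) with ≼-total y p
  ...   | inj₁ y≼p =
    inj₂ (y , y∈S , λ { a (here refl) _ → ≼-refl ; a (there a∈) a∈S → ≼-trans y≼p (min a a∈ a∈S) })
  ...   | inj₂ p≼y = inj₂ (p , p∈S , λ { a (here refl) _ → p≼y ; a (there a∈) → min a a∈ })

  argmin-Subset : (S : Subset n) → ∀ {a} → a ∈ S → ∃ λ p → p ∈ S × ∀ b → b ∈ S → p ≼ b
  argmin-Subset S {a} a∈S with argmin S (allFin n)
  ... | inj₁ none            = ⊥-elim (none a (∈-allFin a) a∈S)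
  ... | inj₂ (p , p∈S , min) = p , p∈S , λ b → min b (∈-allFin b)

crossing : ∀ {Q : ℕ → Set} → (∀ j → Dec (Q j)) → ∀ k → Q 0 → ¬ Q k → ∃ λ ℓ → ℓ ℕ.< k × Q ℓ × ¬ Q (suc ℓ)
crossing Q? zero    Q0 ¬Qk = ⊥-elim (¬Qk Q0)
crossing Q? (suc k) Q0 ¬Qk with Q? k
... | yes Qk = k , ℕ.≤-refl , Qk , ¬Qk
... | no ¬Qk′ with crossing Q? k Q0 ¬Qk′
...   | ℓ , ℓ<k , Qℓ , ¬Qℓ+1 = ℓ , ℕ.m<n⇒m<1+n ℓ<k , Qℓ , ¬Qℓ+1

ℕ→ℚ-nonneg : ∀ m → 0ℚ ≤ℚ ℕ→ℚ m
ℕ→ℚ-nonneg m = ℚ.nonNegative⁻¹ _ {{ℚ.normalize-nonNeg m 1}}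

ℕ→ℚ≡mkℚ : ∀ m → ℕ→ℚ m ≡ ℚ.mkℚ (ℤ.+ m) 0 (Coprime.sym (1-coprimeTo m))
ℕ→ℚ≡mkℚ m = ℚ.normalize-coprime (Coprime.sym (1-coprimeTo m))

ℕ→ℚ-+ : ∀ a b → ℕ→ℚ (a ℕ.+ b) ≡ ℕ→ℚ a + ℕ→ℚ b
ℕ→ℚ-+ a b rewrite ℕ→ℚ≡mkℚ (a ℕ.+ b) | ℕ→ℚ≡mkℚ a | ℕ→ℚ≡mkℚ b =
  ℚ.toℚᵘ-injective (ℚᵘ.≃-trans (ℚᵘ.*≡* same) (ℚᵘ.≃-sym (ℚ.toℚᵘ-homo-+ (mkℚ a) (mkℚ b))))
  where
  mkℚ : ∀ m → ℚ
  mkℚ m = ℚ.mkℚ (ℤ.+ m) 0 (Coprime.sym (1-coprimeTo m))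

  same : ℤ.+ (a ℕ.+ b) ℤ.* ℤ.+ 1 ≡ (ℤ.+ a ℤ.* ℤ.+ 1 ℤ.+ ℤ.+ b ℤ.* ℤ.+ 1) ℤ.* ℤ.+ 1
  same rewrite ℤ.*-identityʳ (ℤ.+ a) | ℤ.*-identityʳ (ℤ.+ b) | ℤ.*-identityʳ (ℤ.+ a ℤ.+ ℤ.+ b) = ℤ.pos-+ a b

*-monoˡ-≤-0≤ : ∀ {r p q} → 0ℚ ≤ℚ r → p ≤ℚ q → r * p ≤ℚ r * q
*-monoˡ-≤-0≤ {r} 0≤r = ℚ.*-monoˡ-≤-nonNeg r {{ℚ.nonNegative 0≤r}}

0≤* : ∀ {a b} → 0ℚ ≤ℚ a → 0ℚ ≤ℚ b → 0ℚ ≤ℚ a * b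
0≤* {a} 0≤a 0≤b = subst (_≤ℚ a * _) (ℚ.*-zeroʳ a) (*-monoˡ-≤-0≤ 0≤a 0≤b)

≤+0≤ : ∀ {x a} → 0ℚ ≤ℚ a → x ≤ℚ x + a
≤+0≤ {x} 0≤a = subst (_≤ℚ x + _) (ℚ.+-identityʳ x) (ℚ.+-monoʳ-≤ x 0≤a)

1≤^ℚ : ∀ {q} m → 1ℚ ≤ℚ q → 1ℚ ≤ℚ q ^ℚ m
1≤^ℚ zero    1≤q = ℚ.≤-refl
1≤^ℚ {q} (suc m) 1≤q = ℚ.≤-trans 1≤q (subst (_≤ℚ q * (q ^ℚ m)) (ℚ.*-identityʳ q) (*-monoˡ-≤-0≤ 0≤q (1≤^ℚ m 1≤q)))
  where
  0≤q : 0ℚ ≤ℚ q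
  0≤q = ℚ.≤-trans (toWitness {a? = 0ℚ ℚ.≤? 1ℚ} _) 1≤q

module Bounds (Δ e : ℚ) (Δ-5*e≡1 : (Δ - ℕ→ℚ 5) * e ≡ 1ℚ) (0≤e : 0ℚ ≤ℚ e) (5<Δ : ℕ→ℚ 5 <ℚ Δ) where
  open +-*-Solver

  pivotFactor : ℚ
  pivotFactor = ℕ→ℚ 2 * Δ * e

  stretch : ℕ → ℚ
  stretch i = 1ℚ + ℕ→ℚ (8 ℕ.* i) * e

  1≤Δ : 1ℚ ≤ℚ Δ
  1≤Δ = ℚ.<⇒≤ (ℚ.≤-<-trans (toWitness {a? = 1ℚ ℚ.≤? ℕ→ℚ 5} _) 5<Δ)

  0≤Δ : 0ℚ ≤ℚ Δ
  0≤Δ = ℚ.≤-trans (toWitness {a? = 0ℚ ℚ.≤? 1ℚ} _) 1≤Δ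

  1≤3Δ : 1ℚ ≤ℚ ℕ→ℚ 3 * Δ
  1≤3Δ = ℚ.≤-trans (toWitness {a? = 1ℚ ℚ.≤? ℕ→ℚ 3} _)
                   (subst (_≤ℚ ℕ→ℚ 3 * Δ) (ℚ.*-identityʳ (ℕ→ℚ 3)) (*-monoˡ-≤-0≤ (ℕ→ℚ-nonneg 3) 1≤Δ))

  ≤Δ* : ∀ {x} → 0ℚ ≤ℚ x → x ≤ℚ Δ * x
  ≤Δ* {x} 0≤x = subst (_≤ℚ Δ * x) (ℚ.*-identityˡ x) (ℚ.*-monoʳ-≤-nonNeg x {{ℚ.nonNegative 0≤x}} 1≤Δ)

  0≤pivotFactor : 0ℚ ≤ℚ pivotFactor
  0≤pivotFactor = 0≤* (0≤* (ℕ→ℚ-nonneg 2) 0≤Δ) 0≤e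

  -- From (Δ - 5) e = 1:  Δ e = 1 + 5 e,  hence  pivotFactor = 2 + 10 e.
  pivotFactor-expand : ∀ x → pivotFactor * x ≡ (x + x) + ℕ→ℚ 10 * (e * x)
  pivotFactor-expand x = begin
    ℕ→ℚ 2 * Δ * e * x
      ≡⟨ solve 3 (λ Δ e x → con (ℕ→ℚ 2) :* Δ :* e :* x
                         := con (ℕ→ℚ 2) :* ((Δ :- con (ℕ→ℚ 5)) :* e :+ con (ℕ→ℚ 5) :* e) :* x) refl Δ e x ⟩
    ℕ→ℚ 2 * ((Δ - ℕ→ℚ 5) * e + ℕ→ℚ 5 * e) * x
      ≡⟨ cong (λ z → ℕ→ℚ 2 * (z + ℕ→ℚ 5 * e) * x) Δ-5*e≡1 ⟩
    ℕ→ℚ 2 * (1ℚ + ℕ→ℚ 5 * e) * x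
      ≡⟨ solve 2 (λ e x → con (ℕ→ℚ 2) :* (con 1ℚ :+ con (ℕ→ℚ 5) :* e) :* x
                       := (x :+ x) :+ con (ℕ→ℚ 10) :* (e :* x)) refl e x ⟩
    (x + x) + ℕ→ℚ 10 * (e * x) ∎
    where open ≡-Reasoning

  pivotFactor*L≤ : ∀ {L d} → Δ * L ≤ℚ d → pivotFactor * L ≤ℚ ℕ→ℚ 2 * (e * d)
  pivotFactor*L≤ {L} {d} ΔL≤d = begin
    pivotFactor * L
      ≡⟨ solve 3 (λ Δ e L → con (ℕ→ℚ 2) :* Δ :* e :* L := (con (ℕ→ℚ 2) :* e) :* (Δ :* L)) refl Δ e L ⟩
    (ℕ→ℚ 2 * e) * (Δ * L) ≤⟨ *-monoˡ-≤-0≤ (0≤* (ℕ→ℚ-nonneg 2) 0≤e) ΔL≤d ⟩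
    (ℕ→ℚ 2 * e) * d       ≡⟨ ℚ.*-assoc (ℕ→ℚ 2) e d ⟩
    ℕ→ℚ 2 * (e * d)       ∎
    where open ℚ.≤-Reasoning

  stretch-suc : ∀ i d → stretch (suc i) * d ≡ stretch i * d + ℕ→ℚ 8 * (e * d)
  stretch-suc i d = begin
    (1ℚ + ℕ→ℚ (8 ℕ.* suc i) * e) * d       ≡⟨ cong (λ z → (1ℚ + ℕ→ℚ z * e) * d) (ℕ.*-suc 8 i) ⟩
    (1ℚ + ℕ→ℚ (8 ℕ.+ 8 ℕ.* i) * e) * d     ≡⟨ cong (λ z → (1ℚ + z * e) * d) (ℕ→ℚ-+ 8 (8 ℕ.* i)) ⟩
    (1ℚ + (ℕ→ℚ 8 + ℕ→ℚ (8 ℕ.* i)) * e) * d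
      ≡⟨ solve 3 (λ m e d → (con 1ℚ :+ (con (ℕ→ℚ 8) :+ m) :* e) :* d
                         := (con 1ℚ :+ m :* e) :* d :+ con (ℕ→ℚ 8) :* (e :* d)) refl (ℕ→ℚ (8 ℕ.* i)) e d ⟩
    stretch i * d + ℕ→ℚ 8 * (e * d)        ∎
    where open ≡-Reasoning

  stretch-zero : ∀ d → d ≤ℚ stretch 0 * d
  stretch-zero d = ℚ.≤-reflexive (solve 2 (λ e d → d := (con 1ℚ :+ con (ℕ→ℚ 0) :* e) :* d) refl e d)

  stretch-mono : ∀ i {d} → 0ℚ ≤ℚ d → stretch i * d ≤ℚ stretch (suc i) * d
  stretch-mono i {d} 0≤d =
    subst (stretch i * d ≤ℚ_) (sym (stretch-suc i d)) (≤+0≤ (0≤* (ℕ→ℚ-nonneg 8) (0≤* 0≤e 0≤d)))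

  double≤pivotFactor : ∀ {d} → 0ℚ ≤ℚ d → d + d ≤ℚ pivotFactor * d
  double≤pivotFactor {d} 0≤d =
    subst (d + d ≤ℚ_) (sym (pivotFactor-expand d)) (≤+0≤ (0≤* (ℕ→ℚ-nonneg 10) (0≤* 0≤e 0≤d)))

  -- The two alternatives of the detour through the pivots z₁ of m and z₂ of m′ on a shortest path
  -- x ⋯ m ⋯ m′ ⋯ y: α = d(x,m), β = d(m,m′), β′ = d(m′,y), ρ = pivotFactor * L bounds d(m,z₁) and
  -- d(m′,z₂), and g = d(z₁,z₂).
  detour-pivot-bound : ∀ {α β g d L} → 0ℚ ≤ℚ α → α + β ≤ℚ d → g ≤ℚ pivotFactor * L + β + pivotFactor * L
                     → Δ * L ≤ℚ d → (α + pivotFactor * L) + (g + g) ≤ℚ pivotFactor * d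
  detour-pivot-bound {α} {β} {g} {d} {L} 0≤α α+β≤d g≤ ΔL≤d = begin
    (α + ρ) + (g + g)                         ≤⟨ ℚ.+-monoʳ-≤ (α + ρ) (ℚ.+-mono-≤ g≤ g≤) ⟩
    (α + ρ) + ((ρ + β + ρ) + (ρ + β + ρ))     ≤⟨ ≤+0≤ 0≤α ⟩
    (α + ρ) + ((ρ + β + ρ) + (ρ + β + ρ)) + α
      ≡⟨ solve 3 (λ α β ρ → (α :+ ρ) :+ ((ρ :+ β :+ ρ) :+ (ρ :+ β :+ ρ)) :+ α
                         := ((α :+ β) :+ (α :+ β)) :+ con (ℕ→ℚ 5) :* ρ) refl α β ρ ⟩
    ((α + β) + (α + β)) + ℕ→ℚ 5 * ρ
      ≤⟨ ℚ.+-mono-≤ (ℚ.+-mono-≤ α+β≤d α+β≤d) (*-monoˡ-≤-0≤ (ℕ→ℚ-nonneg 5) (pivotFactor*L≤ ΔL≤d)) ⟩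
    (d + d) + ℕ→ℚ 5 * (ℕ→ℚ 2 * (e * d))
      ≡⟨ cong ((d + d) +_) (solve 1 (λ x → con (ℕ→ℚ 5) :* (con (ℕ→ℚ 2) :* x) := con (ℕ→ℚ 10) :* x) refl (e * d)) ⟩
    (d + d) + ℕ→ℚ 10 * (e * d)                ≡⟨ sym (pivotFactor-expand d) ⟩
    pivotFactor * d                           ∎
    where
    open ℚ.≤-Reasoning
    ρ : ℚ
    ρ = pivotFactor * L

  detour-stretch-bound : ∀ i {α β β′ g d L} → α + (β′ + β) ≡ d → 0ℚ ≤ℚ β
                       → g ≤ℚ pivotFactor * L + β + pivotFactor * L → Δ * L ≤ℚ d
                       → (((stretch i * α + pivotFactor * L) + g) + pivotFactor * L) + stretch i * β′
                           ≤ℚ stretch (suc i) * d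
  detour-stretch-bound i {α} {β} {β′} {g} {d} {L} d≡ 0≤β g≤ ΔL≤d = begin
    (((c * α + ρ) + g) + ρ) + c * β′
      ≤⟨ ℚ.+-monoˡ-≤ (c * β′) (ℚ.+-monoˡ-≤ ρ (ℚ.+-monoʳ-≤ (c * α + ρ) g≤)) ⟩
    (((c * α + ρ) + (ρ + β + ρ)) + ρ) + c * β′
      ≤⟨ ≤+0≤ (0≤* (0≤* (ℕ→ℚ-nonneg (8 ℕ.* i)) 0≤e) 0≤β) ⟩
    (((c * α + ρ) + (ρ + β + ρ)) + ρ) + c * β′ + (ℕ→ℚ (8 ℕ.* i) * e) * β
      ≡⟨ solve 6 (λ m e α β β′ ρ → (((((con 1ℚ :+ m :* e) :* α :+ ρ) :+ (ρ :+ β :+ ρ)) :+ ρ)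
                                      :+ (con 1ℚ :+ m :* e) :* β′) :+ (m :* e) :* β
                                := (con 1ℚ :+ m :* e) :* (α :+ (β′ :+ β)) :+ con (ℕ→ℚ 4) :* ρ)
                 refl (ℕ→ℚ (8 ℕ.* i)) e α β β′ ρ ⟩
    c * (α + (β′ + β)) + ℕ→ℚ 4 * ρ     ≡⟨ cong (λ z → c * z + ℕ→ℚ 4 * ρ) d≡ ⟩
    c * d + ℕ→ℚ 4 * ρ
      ≤⟨ ℚ.+-monoʳ-≤ (c * d) (*-monoˡ-≤-0≤ (ℕ→ℚ-nonneg 4) (pivotFactor*L≤ ΔL≤d)) ⟩
    c * d + ℕ→ℚ 4 * (ℕ→ℚ 2 * (e * d))
      ≡⟨ cong (c * d +_) (solve 1 (λ x → con (ℕ→ℚ 4) :* (con (ℕ→ℚ 2) :* x) := con (ℕ→ℚ 8) :* x) refl (e * d)) ⟩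
    c * d + ℕ→ℚ 8 * (e * d)            ≡⟨ sym (stretch-suc i d) ⟩
    stretch (suc i) * d                ∎
    where
    open ℚ.≤-Reasoning
    c ρ : ℚ
    c = stretch i
    ρ = pivotFactor * L

module Spanner {n : ℕ} (G : Graph n) (k : ℕ) (1≤k : 1 ≤ k)
  (A : ℕ → Subset n) (O : Outcome G k A)
  (dG : Fin n → Fin n → ℚ∞) (dG-spec : ∀ x y → IsDist G (AllEdges G) x y (dG x y))
  (P : Fin n → Fin n → Maybe (List (Fin n))) (Pch : ShortestPathChoice G dG P)
  (dH : Fin n → Fin n → ℚ∞) (dH-spec : ∀ x y → IsDist G (InH G k A dG P) x y (dH x y)) where

  open Outcome O
  open ShortestPathChoice Pch
  module DG = Distance G (AllEdges G) dG dG-spec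
  module DH = Distance G (InH G k A dG P) dH dH-spec

  InH-sym : Symmetric (InH G k A dG P)
  InH-sym (u , v , vs , b , e , inj₁ m) = u , v , vs , b , e , inj₂ m
  InH-sym (u , v , vs , b , e , inj₂ m) = u , v , vs , b , e , inj₁ m

  dG-sym : ∀ {x y b} → dG x y ≤∞ fin b → dG y x ≤∞ fin b
  dG-sym = DG.dist-sym _

  dH-sym : ∀ {x y b} → dH x y ≤∞ fin b → dH y x ≤∞ fin b
  dH-sym = DH.dist-sym InH-sym

  dG≤dH : ∀ {x y b} → dH x y ≤∞ fin b → dG x y ≤∞ fin b
  dG≤dH h with DH.dist-walk h
  ... | ws , w , l = DG.dist-weaken (DG.dist≤len (walk-mono G _ w)) l

  path-walk-length : ∀ {u v vs} → P u v ≡ just vs → Walk G (AllEdges G) u v vs × dG u v ≡ fin (len G vs)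
  path-walk-length {u} {v} e with spec u v
  ... | inj₁ (e′ , _) with () ← trans (sym e) e′
  ... | inj₂ (_ , e′ , w , _ , d) with refl ← trans (sym e) e′ = w , d

  path-length : ∀ {u v vs} → P u v ≡ just vs → dG u v ≡ fin (len G vs)
  path-length = proj₂ ∘ path-walk-length

  path-dist : ∀ {u v vs} → P u v ≡ just vs → dG u v ≤∞ fin (len G vs)
  path-dist = ≤∞-reflexive ∘ path-length

  dist⇒path : ∀ {u v g} → dG u v ≡ fin g → ∃ λ vs → P u v ≡ just vs × len G vs ≡ g
  dist⇒path {u} {v} e with spec u v
  ... | inj₁ (_ , e′) with () ← trans (sym e) e′
  ... | inj₂ (vs , e′ , _ , _ , d) = vs , e′ , sym (fin-injective (trans (sym e) d))

  halfBunch⇒dH : ∀ {u v g} → InHalfBunch G k A dG u v → dG u v ≡ fin g → dH u v ≤∞ fin g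
  halfBunch⇒dH {u} {v} b e with dist⇒path e
  ... | vs , pe , refl with path-walk-length pe
  ...   | (h , l , a , _) , _ = DH.dist≤len (h , l , a , All.tabulate λ m → u , v , vs , b , pe , inj₁ m)

  path-prefix : ∀ {x y} as m bs → P x y ≡ just (as ++ m ∷ bs) → P x m ≡ just (as ∷ʳ m)
  path-prefix {x} {y} as m bs e =
    subpath x y [] (as ∷ʳ m) bs x m (trans e (cong just (sym (List.∷ʳ-++ as m bs))))
      (trans (sym (head-++-∷ as m bs)) (proj₁ (proj₁ (path-walk-length e)))) (last-∷ʳ as m)

  path-suffix : ∀ {x y} as m bs → P x y ≡ just (as ++ m ∷ bs) → P m y ≡ just (m ∷ bs)
  path-suffix {x} {y} as m bs e =
    subpath x y as (m ∷ bs) [] m y (trans e (cong (λ z → just (as ++ z)) (sym (List.++-identityʳ (m ∷ bs)))))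
      refl (trans (sym (last-++-∷ as m bs)) (proj₁ (proj₂ (proj₁ (path-walk-length e)))))

  ∉A-k : ∀ {u} → u ∉ A k
  ∉A-k h = ∉⊥ (subst (_ ∈_) Ak h)

  ∈A⇒<k : ∀ {j u} → j ℕ.≤ k → u ∈ A j → j ℕ.< k
  ∈A⇒<k j≤k u∈ = ℕ.≤∧≢⇒< j≤k λ { refl → ∉A-k u∈ }

  A-antitone : ∀ {i j u} → i ℕ.≤ j → j ℕ.< k → u ∈ A j → u ∈ A i
  A-antitone {j = zero}  ℕ.z≤n _ h = h
  A-antitone {j = suc j} i≤j j<k h with ℕ.m≤n⇒m<n∨m≡n i≤j
  ... | inj₂ refl = h
  ... | inj₁ i<j  = A-antitone (ℕ.≤-pred i<j) (ℕ.<-trans (ℕ.n<1+n j) j<k) (nested j j<k h)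

  Level : Fin n → ℕ → Set
  Level u ℓ = ℓ ℕ.< k × u ∈ A ℓ × u ∉ A (suc ℓ)

  level : ∀ u → ∃ (Level u)
  level u = crossing (λ j → u ∈? A j) k (subst (u ∈_) (sym A0) ∈⊤) ∉A-k

  level-maximal : ∀ {u ℓ j} → Level u ℓ → u ∈ A j → j ℕ.< k → j ℕ.≤ ℓ
  level-maximal {ℓ = ℓ} {j} (_ , _ , u∉) u∈ j<k with j ℕ.≤? ℓ
  ... | yes j≤ℓ = j≤ℓ
  ... | no j≰ℓ  = ⊥-elim (u∉ (A-antitone (ℕ.≰⇒> j≰ℓ) j<k u∈))

  pivot-exists : ∀ {j a} x → j ℕ.< k → a ∈ A j → ∃ (IsPivot G k A dG j x)
  pivot-exists {j} x j<k a∈ with argmin-Subset (dG x) (A j) a∈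
  ... | p , p∈ , min = p , j<k , p∈ , (λ b b∈ → proj₁ (min b b∈)) , (λ b b∈ → proj₂ (min b b∈))

  pivot∈halfBunch : ∀ {u ℓ j p} → Level u ℓ → ℓ ℕ.< j → IsPivot G k A dG j u p
                  → InHalfBunch G k A dG u p
  pivot∈halfBunch (ℓ<k , u∈ , u∉) ℓ<j piv = _ , ℓ<k , u∈ , u∉ , inj₂ (_ , ℓ<j , piv)

  Near : Fin n → ℕ → ℚ → Set
  Near u j b = ∃ λ a → a ∈ A j × dG u a ≤∞ fin b

  near? : ∀ u j b → Dec (Near u j b)
  near? u j b = Fin.any? λ a → (a ∈? A j) ×-dec (dG u a ≤∞? fin b)

  ¬near⇒far : ∀ {u j b} → ¬ Near u j b → ∀ a → a ∈ A j → fin b <∞ dG u a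
  ¬near⇒far ¬near a a∈ = ≰∞⇒>∞ λ h → ¬near (a , a∈ , h)

  ∈halfBunch : ∀ {u v ℓ g c} → Level u ℓ → v ∈ A ℓ → dG u v ≡ fin g → g + g ≤ℚ c
             → ¬ Near u (suc ℓ) c → InHalfBunch G k A dG u v
  ∈halfBunch {u} {ℓ = ℓ} (ℓ<k , u∈ , u∉) v∈ e g+g≤c ¬near =
    ℓ , ℓ<k , u∈ , u∉ , inj₁ (v∈ , subst (_<∞ half∞ D) (sym e) (+≤⇒<half∞ D g+g≤c far))
    where
    D : ℚ∞
    D = distSet G dG u (A (suc ℓ))

    far : fin _ <∞ D
    far = foldr-⊓∞-glb-< _ (All.map⁺ (All.map (λ {a} → ¬near⇒far ¬near a)
            (All.all-filter (_∈? A (suc ℓ)) (allFin n))))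

  pivot-above-level-dH : ∀ {u ℓ j p g} → Level u ℓ → ℓ ℕ.< j → IsPivot G k A dG j u p
                       → dG u p ≡ fin g → dH u p ≤∞ fin g
  pivot-above-level-dH lu ℓ<j piv = halfBunch⇒dH (pivot∈halfBunch lu ℓ<j piv)

  -- Needed because of zero-weight edges: a vertex of A j and its pivot of level j may differ.
  ZeroLinked : ℕ → Set
  ZeroLinked j = j ℕ.< k → ∀ {u v} → u ∈ A j → v ∈ A j → dG u v ≤∞ fin 0ℚ → dH u v ≤∞ fin 0ℚ

  ZeroPivot : Fin n → ℕ → Set
  ZeroPivot u j = ∃ λ q → q ∈ A j × dG u q ≤∞ fin 0ℚ × dH u q ≤∞ fin 0ℚ

  zero-pivot : ∀ {u ℓ a} → Level u ℓ → a ∈ A (suc ℓ) → dG u a ≤∞ fin 0ℚ → ZeroPivot u (suc ℓ)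
  zero-pivot {u} lu a∈ dua with pivot-exists u (∈A⇒<k (proj₁ lu) a∈) a∈
  ... | q , piv@(_ , q∈ , min , _) with ≤∞-fin⇒fin (≤∞-trans (min _ a∈) dua)
  ...   | g , e , g≤0 = q , q∈ , ≤∞-trans (min _ a∈) dua ,
                        DH.dist-weaken (pivot-above-level-dH lu (ℕ.n<1+n _) piv e) g≤0

  dG-triangle₀ : ∀ {x y z} → dG x y ≤∞ fin 0ℚ → dG y z ≤∞ fin 0ℚ → dG x z ≤∞ fin 0ℚ
  dG-triangle₀ {x} {z = z} h₁ h₂ = subst (λ b → dG x z ≤∞ fin b) (ℚ.+-identityʳ 0ℚ) (DG.dist-triangle h₁ h₂)

  dH-triangle₀ : ∀ {x y z} → dH x y ≤∞ fin 0ℚ → dH y z ≤∞ fin 0ℚ → dH x z ≤∞ fin 0ℚ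
  dH-triangle₀ {x} {z = z} h₁ h₂ = subst (λ b → dH x z ≤∞ fin b) (ℚ.+-identityʳ 0ℚ) (DH.dist-triangle h₁ h₂)

  zero-linked-step : ∀ {u v ℓ} → Level u ℓ → v ∈ A ℓ → dG u v ≤∞ fin 0ℚ → ZeroLinked (suc ℓ)
                   → dH u v ≤∞ fin 0ℚ
  zero-linked-step {u} {v} {ℓ} lu v∈ duv IH = by-nearness (near? u (suc ℓ) 0ℚ)
    where
    in-halfBunch : (∃ λ g → dG u v ≡ fin g × g ≤ℚ 0ℚ) → ¬ Near u (suc ℓ) 0ℚ → dH u v ≤∞ fin 0ℚ
    in-halfBunch (g , e , g≤0) ¬near = DH.dist-weaken (halfBunch⇒dH (∈halfBunch lu v∈ e g+g≤0 ¬near) e) g≤0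
      where
      g+g≤0 : g + g ≤ℚ 0ℚ
      g+g≤0 = subst (g + g ≤ℚ_) (ℚ.+-identityʳ 0ℚ) (ℚ.+-mono-≤ g≤0 g≤0)

    via-pivots : ∀ {a} → a ∈ A (suc ℓ) → dG u a ≤∞ fin 0ℚ → ZeroPivot u (suc ℓ) → Dec (v ∈ A (suc ℓ))
               → dH u v ≤∞ fin 0ℚ
    via-pivots a∈ dua (q , q∈ , duq , hq) (yes v∈′) =
      dH-triangle₀ hq (IH (∈A⇒<k (proj₁ lu) a∈) q∈ v∈′ (dG-triangle₀ (dG-sym duq) duv))
    via-pivots a∈ dua (q , q∈ , duq , hq) (no v∉) =
      to-pivot (zero-pivot (proj₁ lu , v∈ , v∉) a∈ (dG-triangle₀ (dG-sym duv) dua))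
      where
      to-pivot : ZeroPivot v (suc ℓ) → dH u v ≤∞ fin 0ℚ
      to-pivot (q′ , q′∈ , dvq′ , hvq′) =
        dH-triangle₀ hq (dH-triangle₀ (IH (∈A⇒<k (proj₁ lu) a∈) q∈ q′∈ dqq′) (dH-sym hvq′))
        where
        dqq′ : dG q q′ ≤∞ fin 0ℚ
        dqq′ = dG-triangle₀ (dG-sym duq) (dG-triangle₀ duv dvq′)

    by-nearness : Dec (Near u (suc ℓ) 0ℚ) → dH u v ≤∞ fin 0ℚ
    by-nearness (no ¬near)           = in-halfBunch (≤∞-fin⇒fin duv) ¬near
    by-nearness (yes (a , a∈ , dua)) = via-pivots a∈ dua (zero-pivot lu a∈ dua) (v ∈? A (suc ℓ))

  private
    fuel-step : ∀ {t j i} → k ℕ.≤ suc t ℕ.+ j → j ℕ.≤ i → k ℕ.≤ t ℕ.+ suc i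
    fuel-step {t} {j} {i} k≤ j≤i =
      ℕ.≤-trans k≤ (subst (ℕ._≤ t ℕ.+ suc i) (ℕ.+-suc t j) (ℕ.+-monoʳ-≤ t (ℕ.s≤s j≤i)))

  zero-linked : ∀ t j → k ℕ.≤ t ℕ.+ j → ZeroLinked j
  zero-linked zero    j k≤j j<k = ⊥-elim (ℕ.<⇒≱ j<k k≤j)
  zero-linked (suc t) j k≤ j<k {u} {v} u∈ v∈ duv with level u | level v
  ... | ℓ , lu | m , lv with ℓ ℕ.≤? m
  ... | yes ℓ≤m = zero-linked-step lu (A-antitone ℓ≤m (proj₁ lv) (proj₁ (proj₂ lv))) duv
                    (zero-linked t (suc ℓ) (fuel-step k≤ (level-maximal lu u∈ j<k)))
  ... | no ℓ≰m  = dH-sym (zero-linked-step lv (A-antitone (ℕ.<⇒≤ (ℕ.≰⇒> ℓ≰m)) (proj₁ lu) (proj₁ (proj₂ lu)))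
                    (dG-sym duv) (zero-linked t (suc m) (fuel-step k≤ (level-maximal lv v∈ j<k))))

  pivot-dH : ∀ {j x p g} → IsPivot G k A dG j x p → dG x p ≡ fin g → dH x p ≤∞ fin g
  pivot-dH {j} {x} piv@(j<k , p∈ , min , _) e with level x
  ... | ℓ , lx with ℓ ℕ.<? j
  ... | yes ℓ<j = pivot-above-level-dH lx ℓ<j piv e
  ... | no ℓ≮j  = DH.dist-weaken (zero-linked k j (ℕ.m≤m+n k j) j<k x∈ p∈ (≤∞-trans (min x x∈) (DG.dist-refl x)))
                    (DG.dist-nonneg (≤∞-reflexive e))
    where
    x∈ : x ∈ A j
    x∈ = A-antitone (ℕ.≮⇒≥ ℓ≮j) (proj₁ lx) (proj₁ (proj₂ lx))

  PivotWithin : Fin n → ℕ → ℚ → Set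
  PivotWithin x j b = ∃ λ p → IsPivot G k A dG j x p × dH x p ≤∞ fin b

  near⇒pivotWithin : ∀ {x j b} → j ℕ.≤ k → Near x j b → PivotWithin x j b
  near⇒pivotWithin {x} j≤k (a , a∈ , dxa) with pivot-exists x (∈A⇒<k j≤k a∈) a∈
  ... | p , piv@(_ , _ , min , _) with ≤∞-fin⇒fin (≤∞-trans (min a a∈) dxa)
  ...   | g , e , g≤b = p , piv , DH.dist-weaken (pivot-dH piv e) g≤b

  pivotWithin-weaken : ∀ {x j a b} → PivotWithin x j a → a ≤ℚ b → PivotWithin x j b
  pivotWithin-weaken (p , piv , h) a≤b = p , piv , DH.dist-weaken h a≤b

  dG-nonneg : ∀ {x y d} → dG x y ≡ fin d → 0ℚ ≤ℚ d
  dG-nonneg e = DG.dist-nonneg (≤∞-reflexive e)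

  dH-self : ∀ {u} c → dH u u ≤∞ fin (c * 0ℚ)
  dH-self {u} c = subst (λ z → dH u u ≤∞ fin z) (sym (ℚ.*-zeroʳ c)) (DH.dist-refl u)

  module Stretch (Δ e : ℚ) (Δ-5*e≡1 : (Δ - ℕ→ℚ 5) * e ≡ 1ℚ) (0≤e : 0ℚ ≤ℚ e) (5<Δ : ℕ→ℚ 5 <ℚ Δ) where
    open Bounds Δ e Δ-5*e≡1 0≤e 5<Δ

    Claim : ℕ → Set
    Claim i = i ℕ.< k → ∀ {x y d vs} → dG x y ≡ fin d → P x y ≡ just vs
            → ((ℕ→ℚ 3 * Δ) ^ℚ i) * maxW G vs ≤ℚ d
            → dH x y ≤∞ fin (stretch i * d) ⊎ PivotWithin x (suc i) (pivotFactor * d)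

    claim-zero : Claim 0
    claim-zero _ {x} {y} {d} e _ _ with level x
    ... | suc ℓ , ℓ+1<k , x∈ , _ =
      inj₂ (pivotWithin-weaken (near⇒pivotWithin 1≤k (x , A-antitone (ℕ.s≤s ℕ.z≤n) ℓ+1<k x∈ , DG.dist-refl x))
                               (0≤* 0≤pivotFactor (dG-nonneg e)))
    ... | zero , lx with near? x 1 (d + d)
    ...   | yes near = inj₂ (pivotWithin-weaken (near⇒pivotWithin 1≤k near) (double≤pivotFactor (dG-nonneg e)))
    ...   | no ¬near = inj₁ (DH.dist-weaken (halfBunch⇒dH (∈halfBunch lx y∈A0 e ℚ.≤-refl ¬near) e) (stretch-zero d))
      where
      y∈A0 : y ∈ A 0
      y∈A0 = subst (y ∈_) (sym A0) ∈⊤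

    module Step (i : ℕ) (IH : Claim i) (i+1<k : suc i ℕ.< k) (W : ℚ) (0≤W : 0ℚ ≤ℚ W) where

      X T L : ℚ
      X = (ℕ→ℚ 3 * Δ) ^ℚ i
      T = X * W
      L = T + T + T

      0≤X : 0ℚ ≤ℚ X
      0≤X = ℚ.≤-trans (toWitness {a? = 0ℚ ℚ.≤? 1ℚ} _) (1≤^ℚ i 1≤3Δ)

      0≤T : 0ℚ ≤ℚ T
      0≤T = 0≤* 0≤X 0≤W

      W≤T : W ≤ℚ T
      W≤T = subst (_≤ℚ T) (ℚ.*-identityˡ W) (ℚ.*-monoʳ-≤-nonNeg W {{ℚ.nonNegative 0≤W}} (1≤^ℚ i 1≤3Δ))

      T+W+T≤L : ∀ {a b} → a ≤ℚ T + W → b ≤ℚ T → a + b ≤ℚ L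
      T+W+T≤L a≤ b≤ = ℚ.+-mono-≤ (ℚ.≤-trans a≤ (ℚ.+-monoʳ-≤ T W≤T)) b≤

      T+W≤L : ∀ {a} → a ≤ℚ T + W → a ≤ℚ L
      T+W≤L a≤ = ℚ.≤-trans (ℚ.≤-trans a≤ (ℚ.+-monoʳ-≤ T W≤T)) (≤+0≤ 0≤T)

      segment : ∀ {u m s} → P u m ≡ just s → T ≤ℚ len G s → Light G W s
              → dH u m ≤∞ fin (stretch i * len G s) ⊎ PivotWithin u (suc i) (pivotFactor * len G s)
      segment pe T≤ light = IH (ℕ.<-trans (ℕ.n<1+n i) i+1<k) (path-length pe) pe
                               (ℚ.≤-trans (*-monoˡ-≤-0≤ 0≤X (maxW-least G _ 0≤W light)) T≤)

      -- Walking from u towards y along P u y, the induction hypothesis failed at m: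
      -- the pivot of m is close in H, and the path from m on is still long.
      record Obstruction (u y : Fin n) (ℓ : ℚ) : Set where
        field
          m       : Fin n
          α       : ℚ
          suffix  : List (Fin n)
          dH-um   : dH u m ≤∞ fin (stretch i * α)
          dG-um   : dG u m ≤∞ fin α
          path-my : P m y ≡ just suffix
          split   : α + len G suffix ≡ ℓ
          long    : T ≤ℚ len G suffix
          light   : Light G W suffix
          pivot   : PivotWithin m (suc i) (pivotFactor * L)

      Advance : Fin n → Fin n → ℚ → Set
      Advance u y ℓ = dH u y ≤∞ fin (stretch i * ℓ) ⊎ Obstruction u y ℓ

      obstruction-here : ∀ {u y ps} → P u y ≡ just ps → Light G W ps → T ≤ℚ len G ps
                       → PivotWithin u (suc i) (pivotFactor * L) → Obstruction u y (len G ps)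
      obstruction-here {u} {ps = ps} pe light T≤ piv = record
        { m = u ; α = 0ℚ ; suffix = ps ; dH-um = dH-self (stretch i) ; dG-um = DG.dist-refl u ; path-my = pe
        ; split = ℚ.+-identityˡ _ ; long = T≤ ; light = light ; pivot = piv }

      advance-after : ∀ {u m y a ℓ} → dH u m ≤∞ fin (stretch i * a) → dG u m ≤∞ fin a
                    → Advance m y ℓ → Advance u y (a + ℓ)
      advance-after {a = a} {ℓ} hum gum (inj₁ hmy) =
        inj₁ (subst (λ z → dH _ _ ≤∞ fin z) (sym (ℚ.*-distribˡ-+ (stretch i) a ℓ)) (DH.dist-triangle hum hmy))
      advance-after {a = a} {ℓ} hum gum (inj₂ ob) = inj₂ record
        { m = m ; α = a + α ; suffix = suffix
        ; dH-um = subst (λ z → dH _ _ ≤∞ fin z) (sym (ℚ.*-distribˡ-+ (stretch i) a α)) (DH.dist-triangle hum dH-um)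
        ; dG-um = DG.dist-triangle gum dG-um ; path-my = path-my
        ; split = trans (ℚ.+-assoc a α (len G suffix)) (cong (a +_) split)
        ; long = long ; light = light ; pivot = pivot }
        where open Obstruction ob

      march : ∀ f {u y ps} → length ps ℕ.≤ f → P u y ≡ just ps → Light G W ps → T ≤ℚ len G ps
            → Advance u y (len G ps)
      -- The first piece, of length in [T, T + W], is split off; if the rest is shorter than T, the
      -- induction hypothesis is applied to the whole path instead, whose length is then at most L.
      march-split : ∀ f {u y} as m bs → length (m ∷ bs) ℕ.≤ f
                  → T ≤ℚ len G ((u ∷ as) ∷ʳ m) → len G ((u ∷ as) ∷ʳ m) ≤ℚ T + W
                  → P u y ≡ just ((u ∷ as) ++ m ∷ bs) → Light G W ((u ∷ as) ++ m ∷ bs)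
                  → T ≤ℚ len G ((u ∷ as) ++ m ∷ bs)
                  → Advance u y (len G ((u ∷ as) ++ m ∷ bs))

      march f {ps = []} _ pe _ _ with () ← proj₁ (proj₁ (path-walk-length pe))
      march f {ps = _ ∷ []} _ pe _ _ with path-walk-length pe
      ... | (refl , refl , _) , _ = inj₁ (dH-self (stretch i))
      march (suc f) {u} {y} {u′ ∷ v ∷ rest} (ℕ.s≤s len≤) pe light T≤ =
        from-head (proj₁ (proj₁ (path-walk-length pe))) pe light T≤
        where
        from-head : just u′ ≡ just u → P u y ≡ just (u′ ∷ v ∷ rest) → Light G W (u′ ∷ v ∷ rest)
                  → T ≤ℚ len G (u′ ∷ v ∷ rest) → Advance u y (len G (u′ ∷ v ∷ rest))
        from-head refl pe light T≤ = split-at (light-prefix G u v rest 0≤T light T≤)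
          where
          split-at : (∃ λ as → ∃ λ m → ∃ λ bs → u ∷ v ∷ rest ≡ (u ∷ as) ++ m ∷ bs
                        × T ≤ℚ len G ((u ∷ as) ∷ʳ m) × len G ((u ∷ as) ∷ʳ m) ≤ℚ T + W)
                   → Advance u y (len G (u ∷ v ∷ rest))
          split-at (as , m , bs , eq , T≤seg , seg≤) =
            subst (λ ws → length ws ℕ.≤ suc f → P u y ≡ just ws → Light G W ws → T ≤ℚ len G ws
                        → Advance u y (len G ws))
                  (sym eq) (λ len≤′ → march-split f as m bs (rem≤ len≤′) T≤seg seg≤) (ℕ.s≤s len≤) pe light T≤
            where
            rem≤ : length ((u ∷ as) ++ m ∷ bs) ℕ.≤ suc f → length (m ∷ bs) ℕ.≤ f
            rem≤ (ℕ.s≤s h) = ℕ.≤-trans (ℕ.m≤n+m _ (length as)) (subst (ℕ._≤ f) (List.length-++ as) h)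

      march-split f {u} {y} as m bs len≤ T≤seg seg≤ pe light T≤ = decide (T ℚ.≤? len G (m ∷ bs))
        where
        len-split : len G ((u ∷ as) ++ m ∷ bs) ≡ len G ((u ∷ as) ∷ʳ m) + len G (m ∷ bs)
        len-split = len-++-∷ G (u ∷ as) m bs

        lights : Light G W ((u ∷ as) ∷ʳ m) × Light G W (m ∷ bs)
        lights = light-++-∷ G (u ∷ as) m bs light

        decide : Dec (T ≤ℚ len G (m ∷ bs)) → Advance u y (len G ((u ∷ as) ++ m ∷ bs))
        decide (yes T≤rem) with segment (path-prefix (u ∷ as) m bs pe) T≤seg (proj₁ lights)
        ... | inj₂ piv =
          inj₂ (obstruction-here pe light T≤ (pivotWithin-weaken piv (*-monoˡ-≤-0≤ 0≤pivotFactor (T+W≤L seg≤))))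
        ... | inj₁ hseg = subst (Advance u y) (sym len-split)
          (advance-after hseg (path-dist (path-prefix (u ∷ as) m bs pe))
             (march f len≤ (path-suffix (u ∷ as) m bs pe) (proj₂ lights) T≤rem))
        decide (no T≰rem) with segment pe T≤ light
        ... | inj₁ h = inj₁ h
        ... | inj₂ piv = inj₂ (obstruction-here pe light T≤ (pivotWithin-weaken piv (*-monoˡ-≤-0≤ 0≤pivotFactor
                           (subst (_≤ℚ L) (sym len-split) (T+W+T≤L seg≤ (ℚ.<⇒≤ (ℚ.≰⇒> T≰rem)))))))

      ΔL≡ : (ℕ→ℚ 3 * Δ) ^ℚ suc i * W ≡ Δ * L
      ΔL≡ = solve 3 (λ Δ X W → (con (ℕ→ℚ 3) :* Δ :* X) :* W := Δ :* (X :* W :+ X :* W :+ X :* W)) refl Δ X W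
        where open +-*-Solver

      T≤ : ∀ {d} → Δ * L ≤ℚ d → T ≤ℚ d
      T≤ ΔL≤d = ℚ.≤-trans (ℚ.≤-trans (≤+0≤ 0≤T) (≤+0≤ 0≤T)) (ℚ.≤-trans (≤Δ* 0≤L) ΔL≤d)
        where
        0≤L : 0ℚ ≤ℚ L
        0≤L = ℚ.+-mono-≤ (ℚ.+-mono-≤ 0≤T 0≤T) 0≤T

      Goal : Fin n → Fin n → ℚ → Set
      Goal x y d = dH x y ≤∞ fin (stretch (suc i) * d) ⊎ PivotWithin x (suc (suc i)) (pivotFactor * d)

      -- The march from x stopped at m, the march back from y along the same path stopped at m′;
      -- the pivots z₁ of m and z₂ of m′ are either joined in H or give x a close pivot of level i + 2.
      module Detour {x y d} (ob : Obstruction x y d)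
                    (ob′ : Obstruction y (Obstruction.m ob) (len G (reverse (Obstruction.suffix ob))))
                    (ΔL≤d : Δ * L ≤ℚ d) where
        module O = Obstruction ob
        module O′ = Obstruction ob′

        z₁ z₂ : Fin n
        z₁ = proj₁ O.pivot
        z₂ = proj₁ O′.pivot

        β : ℚ
        β = len G O′.suffix

        d≡ : O.α + (O′.α + β) ≡ d
        d≡ = trans (cong (O.α +_) (trans O′.split (len-reverse G O.suffix))) O.split

        dH-mz₁ : dH O.m z₁ ≤∞ fin (pivotFactor * L)
        dH-mz₁ = proj₂ (proj₂ O.pivot)

        dH-m′z₂ : dH O′.m z₂ ≤∞ fin (pivotFactor * L)
        dH-m′z₂ = proj₂ (proj₂ O′.pivot)

        dG-mm′ : dG O.m O′.m ≤∞ fin β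
        dG-mm′ = dG-sym (path-dist O′.path-my)

        dG-z₁z₂ : dG z₁ z₂ ≤∞ fin (pivotFactor * L + β + pivotFactor * L)
        dG-z₁z₂ = DG.dist-triangle (DG.dist-triangle (dG-sym (dG≤dH dH-mz₁)) dG-mm′) (dG≤dH dH-m′z₂)

        0≤α : 0ℚ ≤ℚ O.α
        0≤α = DG.dist-nonneg O.dG-um

        α+β≤d : O.α + β ≤ℚ d
        α+β≤d = subst (O.α + β ≤ℚ_) d≡ (ℚ.+-monoʳ-≤ O.α (subst (_≤ℚ O′.α + β) (ℚ.+-identityˡ β)
                  (ℚ.+-monoˡ-≤ β (DG.dist-nonneg O′.dG-um))))

        joined : ∀ {g} → dG z₁ z₂ ≡ fin g → g ≤ℚ pivotFactor * L + β + pivotFactor * L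
               → Dec (Near z₁ (suc (suc i)) (g + g)) → Goal x y d
        joined {g} e g≤ (yes (a , a∈ , dz₁a)) =
          inj₂ (pivotWithin-weaken (near⇒pivotWithin i+1<k (a , a∈ , dxa)) (detour-pivot-bound 0≤α α+β≤d g≤ ΔL≤d))
          where
          dxa : dG x a ≤∞ fin ((O.α + pivotFactor * L) + (g + g))
          dxa = DG.dist-triangle (DG.dist-triangle O.dG-um (dG≤dH dH-mz₁)) dz₁a
        joined {g} e g≤ (no ¬near) =
          inj₁ (DH.dist-weaken (DH.dist-triangle (DH.dist-triangle (DH.dist-triangle (DH.dist-triangle
                  O.dH-um dH-mz₁) dH-z₁z₂) (dH-sym dH-m′z₂)) (dH-sym O′.dH-um))
               (detour-stretch-bound i d≡ (len-nonneg G O′.suffix) g≤ ΔL≤d))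
          where
          0≤g+g : 0ℚ ≤ℚ g + g
          0≤g+g = ℚ.≤-trans (dG-nonneg e) (≤+0≤ (dG-nonneg e))

          z₁∉ : z₁ ∉ A (suc (suc i))
          z₁∉ z₁∈ = ¬near (z₁ , z₁∈ , DG.dist-weaken (DG.dist-refl z₁) 0≤g+g)

          z₁-level : Level z₁ (suc i)
          z₁-level = i+1<k , proj₁ (proj₂ (proj₁ (proj₂ O.pivot))) , z₁∉

          dH-z₁z₂ : dH z₁ z₂ ≤∞ fin g
          dH-z₁z₂ = halfBunch⇒dH (∈halfBunch z₁-level (proj₁ (proj₂ (proj₁ (proj₂ O′.pivot)))) e ℚ.≤-refl ¬near) e

        detour : Goal x y d
        detour = let g , e , g≤ = ≤∞-fin⇒fin dG-z₁z₂ in joined e g≤ (near? z₁ (suc (suc i)) (g + g))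

      module _ {x y vs} (ob : Obstruction x y (len G vs)) (ΔL≤ : Δ * L ≤ℚ len G vs) where
        private
          module O = Obstruction ob

          stretch-split : stretch i * O.α + stretch i * len G (reverse O.suffix) ≡ stretch i * len G vs
          stretch-split = begin
            stretch i * O.α + stretch i * len G (reverse O.suffix)
              ≡⟨ sym (ℚ.*-distribˡ-+ (stretch i) O.α _) ⟩
            stretch i * (O.α + len G (reverse O.suffix))
              ≡⟨ cong (λ z → stretch i * (O.α + z)) (len-reverse G O.suffix) ⟩
            stretch i * (O.α + len G O.suffix)
              ≡⟨ cong (stretch i *_) O.split ⟩
            stretch i * len G vs ∎
            where open ≡-Reasoning

        march-back : Goal x y (len G vs)
        march-back = [ direct , (λ ob′ → Detour.detour ob ob′ ΔL≤) ]′
          (march (length (reverse O.suffix)) ℕ.≤-refl (symm _ _ _ O.path-my) (light-reverse G O.suffix O.light)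
                 (subst (T ≤ℚ_) (sym (len-reverse G O.suffix)) O.long))
          where
          direct : dH y O.m ≤∞ fin (stretch i * len G (reverse O.suffix)) → Goal x y (len G vs)
          direct hym = inj₁ (DH.dist-weaken (DH.dist-triangle O.dH-um (dH-sym hym))
                               (ℚ.≤-trans (ℚ.≤-reflexive stretch-split) (stretch-mono i (len-nonneg G vs))))

      conclude : ∀ {x y vs} → P x y ≡ just vs → Light G W vs → (ℕ→ℚ 3 * Δ) ^ℚ suc i * W ≤ℚ len G vs
               → Goal x y (len G vs)
      conclude {vs = vs} pe light hyp =
        [ (λ h → inj₁ (DH.dist-weaken h (stretch-mono i (len-nonneg G vs))))
        , (λ ob → march-back {vs = vs} ob ΔL≤)
        ]′ (march (length vs) ℕ.≤-refl pe light (T≤ ΔL≤))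
        where
        ΔL≤ : Δ * L ≤ℚ len G vs
        ΔL≤ = subst (_≤ℚ len G vs) ΔL≡ hyp

    claim-suc : ∀ {i} → Claim i → Claim (suc i)
    claim-suc {i} IH i+1<k {vs = vs} e pe hyp with refl ← fin-injective (trans (sym e) (path-length pe)) =
      Step.conclude i IH i+1<k (maxW G vs) (maxW-nonneg G vs) pe (light-maxW G vs) hyp

    claim : ∀ i → Claim i
    claim zero    = claim-zero
    claim (suc i) = claim-suc (claim i)

Δ-5-positive : ∀ Δ → ℕ→ℚ 5 <ℚ Δ → ℚ.Positive (Δ - ℕ→ℚ 5)
Δ-5-positive Δ 5<Δ = ℚ.positive (subst (ℚ._< Δ - ℕ→ℚ 5) (ℚ.+-inverseʳ (ℕ→ℚ 5)) (ℚ.+-monoˡ-< (ℚ.- ℕ→ℚ 5) 5<Δ))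

Δ-5*inv-sub5≡1 : ∀ Δ (5<Δ : ℕ→ℚ 5 <ℚ Δ) → (Δ - ℕ→ℚ 5) * inv-sub5 Δ 5<Δ ≡ 1ℚ
Δ-5*inv-sub5≡1 Δ 5<Δ = trans (cong ((Δ - ℕ→ℚ 5) *_) (ℚ.*-identityˡ (ℚ.1/_ (Δ - ℕ→ℚ 5) {{Δ-5≢0}})))
                             (ℚ.*-inverseʳ (Δ - ℕ→ℚ 5) {{Δ-5≢0}})
  where
  Δ-5≢0 : ℚ.NonZero (Δ - ℕ→ℚ 5)
  Δ-5≢0 = ℚ.pos⇒nonZero (Δ - ℕ→ℚ 5) {{Δ-5-positive Δ 5<Δ}}

0≤inv-sub5 : ∀ Δ (5<Δ : ℕ→ℚ 5 <ℚ Δ) → 0ℚ ≤ℚ inv-sub5 Δ 5<Δ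
0≤inv-sub5 Δ 5<Δ = subst (0ℚ ≤ℚ_) (sym (ℚ.*-identityˡ inverse))
  (ℚ.<⇒≤ (ℚ.positive⁻¹ inverse {{ℚ.1/pos⇒pos (Δ - ℕ→ℚ 5) {{Δ-5-positive Δ 5<Δ}}}}))
  where
  inverse : ℚ
  inverse = ℚ.1/_ (Δ - ℕ→ℚ 5) {{ℚ.pos⇒nonZero (Δ - ℕ→ℚ 5) {{Δ-5-positive Δ 5<Δ}}}}

lemmaD3 : (n : ℕ) (G : Graph n) (k : ℕ) → 1 ≤ k
    → (A : ℕ → Subset n) → Outcome G k A
    → (dG : Fin n → Fin n → ℚ∞) → (∀ x y → IsDist G (AllEdges G) x y (dG x y))
    → (P : Fin n → Fin n → Maybe (List (Fin n))) → ShortestPathChoice G dG P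
    → (dH : Fin n → Fin n → ℚ∞) → (∀ x y → IsDist G (InH G k A dG P) x y (dH x y))
    → (Δ : ℚ) → (Δ>5 : ℕ→ℚ 5 <ℚ Δ)
    → (i : ℕ) → i < k
    → (x y : Fin n) (d : ℚ) → dG x y ≡ fin d
    → (vs : List (Fin n)) → P x y ≡ just vs
    → ((ℕ→ℚ 3 * Δ) ^ℚ i) * maxW G vs ≤ℚ d
    → (dH x y ≤∞ fin ((1ℚ + ℕ→ℚ (8 *ℕ i) * inv-sub5 Δ Δ>5) * d))
      ⊎ (∃ λ p → IsPivot G k A dG (suc i) x p
               × dH x p ≤∞ fin ((ℕ→ℚ 2 * Δ) * inv-sub5 Δ Δ>5 * d))
lemmaD3 n G k 1≤k A O dG dG-spec P Pch dH dH-spec Δ 5<Δ i i<k x y d e vs pe hyp =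
  Spanner.Stretch.claim G k 1≤k A O dG dG-spec P Pch dH dH-spec
    Δ (inv-sub5 Δ 5<Δ) (Δ-5*inv-sub5≡1 Δ 5<Δ) (0≤inv-sub5 Δ 5<Δ) 5<Δ i i<k e pe hyp
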